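{- Let $F$ be a totally real number field or a CM field, $n$ a positive integer, and $\boldsymbol{\mu}^{(n+1)}\in(\mathbf{Z}^{n+1})^{I_F}$ a pure dominant weight in a good position, with purity weight $w^{(n+1)}$. If $F$ is totally real, assume that $w^{(n+1)}$ is even. Then there exists a pure dominant weight $\boldsymbol{\mu}^{(n)}\in(\mathbf{Z}^{n})^{I_F}$ in a good position, whose purity weight $w^{(n)}$ has the same parity as $w^{(n+1)}$, such that $\boldsymbol{\mu}^{(n+1)}$ and $\boldsymbol{\mu}^{(n)}$ satisfy the strong interlace condition, i.e. there exists $m_0\in\mathbf{Z}$ with $\boldsymbol{\mu}^{(n+1),\vee}\succapprox\boldsymbol{\mu}^{(n)}+m_0\mathbf{1}$.
   Context: $I_F$ is the set of embeddings $F\hookrightarrow\mathbf{C}$ and $\rho$ is complex conjugation (so $\rho\tau=\tau$ for real $\tau$). An element $\boldsymbol{\mu}=(\boldsymbol{\mu}_\tau)_{\tau\in I_F}$, $\boldsymbol{\mu}_\tau=(\mu_{\tau,1},\dots,\mu_{\tau,N})\in\mathbf{Z}^N$, is dominant if $\mu_{\tau,1}\ge\mu_{\tau,2}\ge\cdots\ge\mu_{\tau,N}$ for all $\tau$. Its contragredient is $\boldsymbol{\mu}^\vee$ with $\boldsymbol{\mu}^\vee_\tau=(-\mu_{\tau,N},\dots,-\mu_{\tau,1})$; $\mathbf{1}=(1,\dots,1)$ in each component. $\boldsymbol\mu$ is pure of purity weight $w\in\mathbf{Z}$ if $\boldsymbol{\mu}_\tau=w\mathbf{1}+\boldsymbol{\mu}^\vee_\tau$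 for real $\tau$ and $\boldsymbol{\mu}_{\rho\tau}=w\mathbf{1}+\boldsymbol{\mu}^\vee_\tau$ for complex $\tau$. A pure dominant $\boldsymbol{\mu}\in(\mathbf{Z}^N)^{I_F}$ of purity weight $w$ is in a good position if $\min\{\mu_{\tau,i},\,w-\mu_{\tau,N+1-i}\}\ge\max\{\mu_{\tau,i+1},\,w-\mu_{\tau,N-i}\}$ for every $\tau\in I_F$ and $i=1,\dots,N-1$. For $\boldsymbol{\lambda}\in(\mathbf{Z}^{n+1})^{I_F}$ and $\boldsymbol{\nu}\in(\mathbf{Z}^n)^{I_F}$, $\boldsymbol{\lambda}\succapprox\boldsymbol{\nu}$ means: for every $\tau\in I_F$ and all $\tilde\tau,\tilde\tau'\in\{\tau,\rho\tau\}$, $\lambda_{\tilde\tau,n+1}\le\nu_{\tilde\tau',n}\le\lambda_{\tilde\tau,n}\le\nu_{\tilde\tau',n-1}\le\cdots\le\lambda_{\tilde\tau,2}\le\nu_{\tilde\tau',1}\le\lambda_{\tilde\tau,1}$. -}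

module Defs where

open import Data.Nat using (ℕ; suc)
open import Data.Fin using (Fin; toℕ; opposite; inject₁) renaming (suc to fsuc)
open import Data.Integer using (ℤ; _-_; -_; _≤_; _⊓_; _⊔_; _+_)
open import Data.Product using (_×_)
open import Data.Sum using (_⊎_)
open import Relation.Binary.PropositionalEquality using (_≡_; _≢_)

-- I_F is modelled as Fin d (d = [F:Q]), complex conjugation as ρ : Fin d → Fin d.
-- A weight in (Z^N)^{I_F}: μ τ i = μ_{τ,i+1} (0-based index i).
Weight : ℕ → ℕ → Set
Weight d N = Fin d → Fin N → ℤ

_ᵛ : ∀ {d N} → Weight d N → Weight d N
(μ ᵛ) τ i = - μ τ (opposite i)

_+𝟏_ : ∀ {d N} → Weight d N → ℤ → Weight d N
(μ +𝟏 m) τ i = μ τ i + m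

Dominant : ∀ {d N} → Weight d N → Set
Dominant {d} {N} μ = ∀ (τ : Fin d) (i j : Fin N) → toℕ i Data.Nat.≤ toℕ j → μ τ j ≤ μ τ i
  where import Data.Nat

-- pure of purity weight w (real τ: ρτ = τ; complex τ: ρτ ≠ τ)
Pure : ∀ {d N} → (Fin d → Fin d) → Weight d N → ℤ → Set
Pure {d} {N} ρ μ w = ∀ (τ : Fin d) →
  (ρ τ ≡ τ → ∀ (i : Fin N) → μ τ i ≡ w + (μ ᵛ) τ i) ×
  (ρ τ ≢ τ → ∀ (i : Fin N) → μ (ρ τ) i ≡ w + (μ ᵛ) τ i)

-- good position: for consecutive 0-based indices a, b = a+1 (i.e. i = a+1 ∈ {1..N-1}):
-- min{μ_{τ,i}, w - μ_{τ,N+1-i}} ≥ max{μ_{τ,i+1}, w - μ_{τ,N-i}}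
GoodPosition : ∀ {d N} → Weight d N → ℤ → Set
GoodPosition {d} {N} μ w = ∀ (τ : Fin d) (a b : Fin N) → toℕ b ≡ suc (toℕ a) →
  (μ τ b ⊔ (w - μ τ (opposite b))) ≤ (μ τ a ⊓ (w - μ τ (opposite a)))

StrongInterlace : ∀ {d n} → (Fin d → Fin d) → Weight d (suc n) → Weight d n → Set
StrongInterlace {d} {n} ρ λ' ν = ∀ (τ t t' : Fin d) →
  (t ≡ τ ⊎ t ≡ ρ τ) → (t' ≡ τ ⊎ t' ≡ ρ τ) →
  ∀ (j : Fin n) → (λ' t (fsuc j) ≤ ν t' j) × (ν t' j ≤ λ' t (inject₁ j))

-- Put λ = μᵛ; it is pure of weight -w.  Rewritten through purity, good position
-- says that both conjugate entries λ_{τ,j+1}, λ_{ρτ,j+1} lie below both of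
-- λ_{τ,j}, λ_{ρτ,j}.  So the interval [max_t λ_{t,j+1}, min_t λ_{t,j}]
-- (t ∈ {τ, ρτ}) is non-empty, and any ν_{τ,j} chosen in it interlaces with λ in
-- the strong sense, with m₀ = 0.  Purity of λ makes the interval for (ρτ, j) the
-- reflection x ↦ -w - x of the one for (τ, n+1-j), so clamping one number C_τ
-- into these intervals gives a pure ν of weight -w as soon as C_{ρτ} = -w - C_τ;
-- it is dominant because the intervals move down with j, and in good position
-- because consecutive intervals do not overlap.  Such a C exists: for F totally
-- real take C = -w/2, and for F CM, where ρ has no fixed points, take C = 0 on one
-- element of each orbit {τ, ρτ} and C = -w on the other.
module Submission where

open import Defs
open import Data.Nat using (ℕ; suc)
open import Data.Fin using (Fin)
open import Data.Integer using (ℤ; _-_; +_)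
open import Data.Integer.Divisibility using (_∣_)
open import Data.Product using (_×_; Σ; ∃; ∃-syntax)
open import Data.Sum using (_⊎_)
open import Relation.Binary.PropositionalEquality using (_≡_; _≢_)

import Data.Nat as ℕ
import Data.Nat.Properties as ℕ
open import Data.Fin using (toℕ; opposite; inject₁; _<_) renaming (suc to fsuc; zero to fzero)
import Data.Fin.Properties as Fin
open import Data.Integer using (_+_; -_; _*_; _⊔_; _⊓_; _≤_)
open import Data.Integer.Properties
import Data.Integer.Divisibility.Signed as Signed
open import Data.Integer.Tactic.RingSolver using (solve-∀)
open import Data.Product using (_,_; proj₁; proj₂)
open import Data.Sum using (inj₁; inj₂)
open import Data.Empty using (⊥-elim)
open import Relation.Nullary using (Dec; yes; no; ¬_)
open import Relation.Binary.PropositionalEquality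
  using (refl; sym; trans; cong; cong₂; subst; subst₂; module ≡-Reasoning)

suc-opposite : ∀ {n} (j : Fin n) → fsuc (opposite j) ≡ opposite (inject₁ j)
suc-opposite {suc n} fzero    = refl
suc-opposite {suc n} (fsuc j) = cong inject₁ (suc-opposite j)

toℕ-opposite-inject₁ : ∀ {n} (j : Fin n) →
  toℕ (opposite (inject₁ j)) ≡ suc (toℕ (opposite (fsuc j)))
toℕ-opposite-inject₁ j = begin
  toℕ (opposite (inject₁ j))       ≡⟨ cong toℕ (sym (suc-opposite j)) ⟩
  suc (toℕ (opposite j))           ≡⟨ cong suc (sym (Fin.toℕ-inject₁ (opposite j))) ⟩
  suc (toℕ (inject₁ (opposite j))) ∎
  where open ≡-Reasoning

reflect-antimono : ∀ W {a b} → a ≤ b → W - b ≤ W - a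
reflect-antimono W a≤b = +-monoʳ-≤ W (neg-mono-≤ a≤b)

reflect-distrib-⊔ : ∀ W a b → W - (a ⊔ b) ≡ (W - a) ⊓ (W - b)
reflect-distrib-⊔ W = antimono-≤-distrib-⊔ (reflect-antimono W)

reflect-distrib-⊓ : ∀ W a b → W - (a ⊓ b) ≡ (W - a) ⊔ (W - b)
reflect-distrib-⊓ W = antimono-≤-distrib-⊓ (reflect-antimono W)

clamp : ℤ → ℤ → ℤ → ℤ
clamp lo hi x = lo ⊔ (hi ⊓ x)

lower≤clamp : ∀ lo hi x → lo ≤ clamp lo hi x
lower≤clamp lo hi x = i≤i⊔j lo (hi ⊓ x)

clamp≤upper : ∀ {lo hi} x → lo ≤ hi → clamp lo hi x ≤ hi
clamp≤upper {hi = hi} x lo≤hi = ⊔-lub lo≤hi (i⊓j≤i hi x)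

clamp-mono-≤ : ∀ {lo lo′ hi hi′} x → lo ≤ lo′ → hi ≤ hi′ → clamp lo hi x ≤ clamp lo′ hi′ x
clamp-mono-≤ x lo≤lo′ hi≤hi′ = ⊔-mono-≤ lo≤lo′ (⊓-monoˡ-≤ x hi≤hi′)

reflect-clamp : ∀ W {lo hi} x → lo ≤ hi →
  W - clamp lo hi x ≡ clamp (W - hi) (W - lo) (W - x)
reflect-clamp W {lo} {hi} x lo≤hi = begin
  W - (lo ⊔ (hi ⊓ x))                        ≡⟨ reflect-distrib-⊔ W lo (hi ⊓ x) ⟩
  (W - lo) ⊓ (W - (hi ⊓ x))                  ≡⟨ cong ((W - lo) ⊓_) (reflect-distrib-⊓ W hi x) ⟩
  (W - lo) ⊓ ((W - hi) ⊔ (W - x))            ≡⟨ cong (_⊓ ((W - hi) ⊔ (W - x)))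
                                                  (sym (i≤j⇒i⊔j≡j (reflect-antimono W lo≤hi))) ⟩
  ((W - hi) ⊔ (W - lo)) ⊓ ((W - hi) ⊔ (W - x)) ≡⟨ sym (⊔-distribˡ-⊓ (W - hi) (W - lo) (W - x)) ⟩
  (W - hi) ⊔ ((W - lo) ⊓ (W - x))            ∎
  where open ≡-Reasoning

ᵛ-dominant : ∀ {d N} {μ : Weight d N} → Dominant μ → Dominant (μ ᵛ)
ᵛ-dominant {N = N} dominant τ i j i≤j = neg-mono-≤ (dominant τ (opposite j) (opposite i) opp-j≤opp-i)
  where
  opp-j≤opp-i : toℕ (opposite j) ℕ.≤ toℕ (opposite i)
  opp-j≤opp-i = subst₂ ℕ._≤_ (sym (Fin.opposite-prop j)) (sym (Fin.opposite-prop i))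
                  (ℕ.∸-monoʳ-≤ N (ℕ.s≤s i≤j))

module Orbits {d : ℕ} (ρ : Fin d → Fin d) (ρ-involutive : ∀ τ → ρ (ρ τ) ≡ τ) where

  InOrbit : Fin d → Fin d → Set
  InOrbit τ t = t ≡ τ ⊎ t ≡ ρ τ

  ⌈_⌉ : ∀ {N} → Weight d N → Weight d N
  ⌈ μ ⌉ τ i = μ τ i ⊔ μ (ρ τ) i

  ⌊_⌋ : ∀ {N} → Weight d N → Weight d N
  ⌊ μ ⌋ τ i = μ τ i ⊓ μ (ρ τ) i

  module _ {N} (μ : Weight d N) where

    ⌈⌉-orbit : ∀ {τ t} i → InOrbit τ t → ⌈ μ ⌉ t i ≡ ⌈ μ ⌉ τ i
    ⌈⌉-orbit i (inj₁ refl)     = refl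
    ⌈⌉-orbit {τ} i (inj₂ refl) =
      trans (cong (λ t → μ (ρ τ) i ⊔ μ t i) (ρ-involutive τ)) (⊔-comm _ _)

    ⌊⌋-orbit : ∀ {τ t} i → InOrbit τ t → ⌊ μ ⌋ t i ≡ ⌊ μ ⌋ τ i
    ⌊⌋-orbit i (inj₁ refl)     = refl
    ⌊⌋-orbit {τ} i (inj₂ refl) =
      trans (cong (λ t → μ (ρ τ) i ⊓ μ t i) (ρ-involutive τ)) (⊓-comm _ _)

    ≤⌈⌉ : ∀ {τ t} i → InOrbit τ t → μ t i ≤ ⌈ μ ⌉ τ i
    ≤⌈⌉ i (inj₁ refl) = i≤i⊔j _ _
    ≤⌈⌉ i (inj₂ refl) = i≤j⊔i _ _

    ⌊⌋≤ : ∀ {τ t} i → InOrbit τ t → ⌊ μ ⌋ τ i ≤ μ t i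
    ⌊⌋≤ i (inj₁ refl) = i⊓j≤i _ _
    ⌊⌋≤ i (inj₂ refl) = i⊓j≤j _ _

    ⌈ᵛ⌉ : ∀ τ i → ⌈ μ ᵛ ⌉ τ i ≡ - ⌊ μ ⌋ τ (opposite i)
    ⌈ᵛ⌉ τ i = sym (neg-distrib-⊓-⊔ _ _)

    ⌊ᵛ⌋ : ∀ τ i → ⌊ μ ᵛ ⌋ τ i ≡ - ⌈ μ ⌉ τ (opposite i)
    ⌊ᵛ⌋ τ i = sym (neg-distrib-⊔-⊓ _ _)

    pure⇒conjugate : ∀ w → Pure ρ μ w → ∀ τ i → μ (ρ τ) i ≡ w + (μ ᵛ) τ i
    pure⇒conjugate w pure τ i with ρ τ Fin.≟ τ
    ... | yes ρτ≡τ = trans (cong (λ t → μ t i) ρτ≡τ) (proj₁ (pure τ) ρτ≡τ i)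
    ... | no  ρτ≢τ = proj₂ (pure τ) ρτ≢τ i

    conjugate⇒pure : ∀ w → (∀ τ i → μ (ρ τ) i ≡ w + (μ ᵛ) τ i) → Pure ρ μ w
    conjugate⇒pure w conj τ = (λ ρτ≡τ i → trans (cong (λ t → μ t i) (sym ρτ≡τ)) (conj τ i))
                          , (λ _ → conj τ)

    pure⇒reflect : ∀ w → Pure ρ μ w → ∀ τ i → μ τ i ≡ w - μ (ρ τ) (opposite i)
    pure⇒reflect w pure τ i = begin
      μ τ i                    ≡⟨ cong (λ t → μ t i) (sym (ρ-involutive τ)) ⟩
      μ (ρ (ρ τ)) i            ≡⟨ pure⇒conjugate w pure (ρ τ) i ⟩
      w - μ (ρ τ) (opposite i) ∎
      where open ≡-Reasoning

    ⌈⌉-reflect : ∀ w → Pure ρ μ w → ∀ τ i → ⌈ μ ⌉ τ i ≡ w - ⌊ μ ⌋ τ (opposite i)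
    ⌈⌉-reflect w pure τ i = begin
      μ τ i ⊔ μ (ρ τ) i
        ≡⟨ cong₂ _⊔_ (pure⇒reflect w pure τ i) (pure⇒reflect w pure (ρ τ) i) ⟩
      (w - μ (ρ τ) (opposite i)) ⊔ (w - μ (ρ (ρ τ)) (opposite i))
        ≡⟨ sym (reflect-distrib-⊓ w _ _) ⟩
      w - ⌊ μ ⌋ (ρ τ) (opposite i)
        ≡⟨ cong (λ x → w - x) (⌊⌋-orbit (opposite i) (inj₂ refl)) ⟩
      w - ⌊ μ ⌋ τ (opposite i) ∎
      where open ≡-Reasoning

    ⌊⌋-reflect : ∀ w → Pure ρ μ w → ∀ τ i → ⌊ μ ⌋ τ i ≡ w - ⌈ μ ⌉ τ (opposite i)
    ⌊⌋-reflect w pure τ i = begin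
      μ τ i ⊓ μ (ρ τ) i
        ≡⟨ cong₂ _⊓_ (pure⇒reflect w pure τ i) (pure⇒reflect w pure (ρ τ) i) ⟩
      (w - μ (ρ τ) (opposite i)) ⊓ (w - μ (ρ (ρ τ)) (opposite i))
        ≡⟨ sym (reflect-distrib-⊔ w _ _) ⟩
      w - ⌈ μ ⌉ (ρ τ) (opposite i)
        ≡⟨ cong (λ x → w - x) (⌈⌉-orbit (opposite i) (inj₂ refl)) ⟩
      w - ⌈ μ ⌉ τ (opposite i) ∎
      where open ≡-Reasoning

    OrbitSeparated : Set
    OrbitSeparated = ∀ τ (a b : Fin N) → toℕ b ≡ suc (toℕ a) → ⌈ μ ⌉ τ b ≤ ⌊ μ ⌋ τ a

    module _ (w : ℤ) (pure : Pure ρ μ w) where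

      private
        conj : ∀ τ i → w - μ τ (opposite i) ≡ μ (ρ τ) i
        conj τ i = sym (pure⇒conjugate w pure τ i)

      goodPosition⇒orbitSeparated : GoodPosition μ w → OrbitSeparated
      goodPosition⇒orbitSeparated gp τ a b b≡1+a =
        subst₂ _≤_ (cong (μ τ b ⊔_) (conj τ b)) (cong (μ τ a ⊓_) (conj τ a)) (gp τ a b b≡1+a)

      orbitSeparated⇒goodPosition : OrbitSeparated → GoodPosition μ w
      orbitSeparated⇒goodPosition sep τ a b b≡1+a =
        subst₂ _≤_ (cong (μ τ b ⊔_) (sym (conj τ b))) (cong (μ τ a ⊓_) (sym (conj τ a)))
          (sep τ a b b≡1+a)

  ᵛ-pure : ∀ {N} {μ : Weight d N} w → Pure ρ μ w → Pure ρ (μ ᵛ) (- w)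
  ᵛ-pure {μ = μ} w pure = conjugate⇒pure (μ ᵛ) (- w) λ τ i →
    trans (cong -_ (pure⇒conjugate μ w pure τ (opposite i))) (negate w (μ τ (opposite (opposite i))))
    where
    negate : ∀ w x → - (w + - x) ≡ - w + - - x
    negate = solve-∀

Skew : ∀ {d} → (Fin d → Fin d) → ℤ → (Fin d → ℤ) → Set
Skew ρ W C = ∀ τ → C (ρ τ) ≡ W - C τ

module Descent {d n : ℕ} (ρ : Fin d → Fin d) (ρ-involutive : ∀ τ → ρ (ρ τ) ≡ τ)
  (μ : Weight d (suc n)) (w : ℤ) (dominant : Dominant μ) (pure : Pure ρ μ w)
  (goodPosition : GoodPosition μ w)
  (C : Fin d → ℤ) (C-skew : Skew ρ (- w) C) where

  open Orbits ρ ρ-involutive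

  λ′ : Weight d (suc n)
  λ′ = μ ᵛ

  lower upper : Fin d → Fin n → ℤ
  lower τ j = ⌈ λ′ ⌉ τ (fsuc j)
  upper τ j = ⌊ λ′ ⌋ τ (inject₁ j)

  ν : Weight d n
  ν τ j = clamp (lower τ j) (upper τ j) (C τ)

  lower≤upper : ∀ τ j → lower τ j ≤ upper τ j
  lower≤upper τ j = subst₂ _≤_ (sym (⌈ᵛ⌉ μ τ (fsuc j))) (sym (⌊ᵛ⌋ μ τ (inject₁ j)))
    (neg-mono-≤ (goodPosition⇒orbitSeparated μ w pure goodPosition τ
      (opposite (fsuc j)) (opposite (inject₁ j)) (toℕ-opposite-inject₁ j)))

  upper≤lower : ∀ τ (a b : Fin n) → toℕ b ≡ suc (toℕ a) → upper τ b ≤ lower τ a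
  upper≤lower τ a b b≡1+a =
    subst (λ k → ⌊ λ′ ⌋ τ k ≤ lower τ a) (sym inject₁b≡1+a)
      (≤-trans (⌊⌋≤ λ′ (fsuc a) (inj₁ refl)) (≤⌈⌉ λ′ (fsuc a) (inj₁ refl)))
    where
    inject₁b≡1+a : inject₁ b ≡ fsuc a
    inject₁b≡1+a = Fin.toℕ-injective (trans (Fin.toℕ-inject₁ b) b≡1+a)

  lower-reflect : ∀ τ j → lower τ j ≡ - w - upper τ (opposite j)
  lower-reflect τ j = ⌈⌉-reflect λ′ (- w) (ᵛ-pure w pure) τ (fsuc j)

  upper-reflect : ∀ τ j → upper τ j ≡ - w - lower τ (opposite j)
  upper-reflect τ j = trans (⌊⌋-reflect λ′ (- w) (ᵛ-pure w pure) τ (inject₁ j))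
                            (cong (λ k → - w - ⌈ λ′ ⌉ τ k) (sym (suc-opposite j)))

  lower≤ν : ∀ {τ t} j → InOrbit τ t → lower τ j ≤ ν t j
  lower≤ν {t = t} j t∈τ = subst (_≤ ν t j) (⌈⌉-orbit λ′ (fsuc j) t∈τ) (lower≤clamp _ _ (C t))

  ν≤upper : ∀ {τ t} j → InOrbit τ t → ν t j ≤ upper τ j
  ν≤upper {t = t} j t∈τ =
    subst (ν t j ≤_) (⌊⌋-orbit λ′ (inject₁ j) t∈τ) (clamp≤upper (C t) (lower≤upper t j))

  ν-conjugate : ∀ τ j → ν (ρ τ) j ≡ - w + (ν ᵛ) τ j
  ν-conjugate τ j = begin
    clamp (lower (ρ τ) j) (upper (ρ τ) j) (C (ρ τ))
      ≡⟨ cong₂ (λ lo hi → clamp lo hi (C (ρ τ))) (⌈⌉-orbit λ′ (fsuc j) (inj₂ refl))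
                                                (⌊⌋-orbit λ′ (inject₁ j) (inj₂ refl)) ⟩
    clamp (lower τ j) (upper τ j) (C (ρ τ))
      ≡⟨ cong₂ (λ lo hi → clamp lo hi (C (ρ τ))) (lower-reflect τ j) (upper-reflect τ j) ⟩
    clamp (- w - upper τ (opposite j)) (- w - lower τ (opposite j)) (C (ρ τ))
      ≡⟨ cong (clamp _ _) (C-skew τ) ⟩
    clamp (- w - upper τ (opposite j)) (- w - lower τ (opposite j)) (- w - C τ)
      ≡⟨ sym (reflect-clamp (- w) (C τ) (lower≤upper τ (opposite j))) ⟩
    - w - ν τ (opposite j) ∎
    where open ≡-Reasoning

  ν-dominant : Dominant ν
  ν-dominant τ i j i≤j = clamp-mono-≤ (C τ)
    (⊔-mono-≤ (λ′-dominant τ (fsuc i) (fsuc j) (ℕ.s≤s i≤j))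
              (λ′-dominant (ρ τ) (fsuc i) (fsuc j) (ℕ.s≤s i≤j)))
    (⊓-mono-≤ (λ′-dominant τ (inject₁ i) (inject₁ j) inject₁-mono)
              (λ′-dominant (ρ τ) (inject₁ i) (inject₁ j) inject₁-mono))
    where
    λ′-dominant : Dominant λ′
    λ′-dominant = ᵛ-dominant dominant
    inject₁-mono : toℕ (inject₁ i) ℕ.≤ toℕ (inject₁ j)
    inject₁-mono = subst₂ ℕ._≤_ (sym (Fin.toℕ-inject₁ i)) (sym (Fin.toℕ-inject₁ j)) i≤j

  ν-pure : Pure ρ ν (- w)
  ν-pure = conjugate⇒pure ν (- w) ν-conjugate

  ν-goodPosition : GoodPosition ν (- w)
  ν-goodPosition = orbitSeparated⇒goodPosition ν (- w) ν-pure separated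
    where
    separated : OrbitSeparated ν
    separated τ a b b≡1+a = ⊔-lub (⊓-glb (step (inj₁ refl) (inj₁ refl)) (step (inj₁ refl) (inj₂ refl)))
                                  (⊓-glb (step (inj₂ refl) (inj₁ refl)) (step (inj₂ refl) (inj₂ refl)))
      where
      step : ∀ {t t′} → InOrbit τ t → InOrbit τ t′ → ν t b ≤ ν t′ a
      step t∈τ t′∈τ = ≤-trans (ν≤upper b t∈τ) (≤-trans (upper≤lower τ a b b≡1+a) (lower≤ν a t′∈τ))

  ν-interlaces : StrongInterlace ρ λ′ ν
  ν-interlaces τ t t′ t∈τ t′∈τ j =
    ≤-trans (≤⌈⌉ λ′ (fsuc j) t∈τ) (lower≤ν j t′∈τ) ,
    ≤-trans (ν≤upper j t′∈τ) (⌊⌋≤ λ′ (inject₁ j) t∈τ)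

strongInterlace-+𝟏0 : ∀ {d n} {ρ : Fin d → Fin d} {λ′ : Weight d (suc n)} {ν : Weight d n} →
  StrongInterlace ρ λ′ ν → StrongInterlace ρ λ′ (ν +𝟏 (+ 0))
strongInterlace-+𝟏0 {λ′ = λ′} {ν} interlace τ t t′ t∈τ t′∈τ j =
  subst (λ′ t (fsuc j) ≤_) (sym (+-identityʳ (ν t′ j))) (proj₁ (interlace τ t t′ t∈τ t′∈τ j)) ,
  subst (_≤ λ′ t (inject₁ j)) (sym (+-identityʳ (ν t′ j))) (proj₂ (interlace τ t t′ t∈τ t′∈τ j))

skew-half : ∀ {d} (ρ : Fin d → Fin d) W → Signed._∣_ (+ 2) W → ∃ (Skew ρ W)
skew-half ρ W (Signed.divides q W≡q*2) = (λ _ → q) , λ _ →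
  trans (half q) (cong (_- q) (sym W≡q*2))
  where
  half : ∀ q → q ≡ q * + 2 - q
  half = solve-∀

skew-fixedPointFree : ∀ {d} (ρ : Fin d → Fin d) → (∀ τ → ρ (ρ τ) ≡ τ) → (∀ τ → ρ τ ≢ τ) →
  ∀ W → ∃ (Skew ρ W)
skew-fixedPointFree ρ ρ-involutive ρ-fixedPointFree W =
  C , λ τ → skew τ (τ Fin.<? ρ τ) (ρ τ Fin.<? ρ (ρ τ))
  where
  pick : ∀ {P : Set} → Dec P → ℤ
  pick (yes _) = + 0
  pick (no _)  = W
  C : _ → ℤ
  C τ = pick (τ Fin.<? ρ τ)
  skew : ∀ τ (τ<ρτ? : Dec (τ < ρ τ)) (ρτ<ρρτ? : Dec (ρ τ < ρ (ρ τ))) →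
    pick ρτ<ρρτ? ≡ W - pick τ<ρτ?
  skew τ (yes τ<ρτ) (yes ρτ<ρρτ) =
    ⊥-elim (Fin.<-asym τ<ρτ (subst (ρ τ <_) (ρ-involutive τ) ρτ<ρρτ))
  skew τ (yes _)    (no _)       = sym (+-identityʳ W)
  skew τ (no _)     (yes _)      = sym (+-inverseʳ W)
  skew τ (no τ≮ρτ)  (no ρτ≮ρρτ)  =
    ⊥-elim (ρ-fixedPointFree τ (Fin.≤-antisym (ℕ.≮⇒≥ τ≮ρτ) (ℕ.≮⇒≥ ρτ≮τ)))
    where
    ρτ≮τ : ¬ (ρ τ < τ)
    ρτ≮τ = subst (λ t → ¬ (ρ τ < t)) (ρ-involutive τ) ρτ≮ρρτ

realOrCM⇒skew : ∀ {d} (ρ : Fin d → Fin d) → (∀ τ → ρ (ρ τ) ≡ τ) → ∀ w →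
  (((∀ τ → ρ τ ≡ τ) × ((+ 2) ∣ w)) ⊎ (∀ τ → ρ τ ≢ τ)) → ∃ (Skew ρ (- w))
-- For F totally real only the parity of w is needed, not that ρ is trivial.
realOrCM⇒skew ρ _ w (inj₁ (_ , 2∣w)) = skew-half ρ (- w) (Signed.∣m⇒∣-m (Signed.∣ᵤ⇒∣ 2∣w))
realOrCM⇒skew ρ ρ-involutive w (inj₂ ρ-fixedPointFree) =
  skew-fixedPointFree ρ ρ-involutive ρ-fixedPointFree (- w)

lemma7p6 : (d : ℕ) → 1 Data.Nat.≤ d → (ρ : Fin d → Fin d) → (∀ τ → ρ (ρ τ) ≡ τ) →
    (n : ℕ) → 1 Data.Nat.≤ n →
    (μ : Weight d (suc n)) → (w : ℤ) →
    Dominant μ → Pure ρ μ w → GoodPosition μ w →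
    (((∀ τ → ρ τ ≡ τ) × ((+ 2) ∣ w)) ⊎ (∀ τ → ρ τ ≢ τ)) →
    ∃[ ν ] ∃[ w' ] (Dominant ν × Pure ρ ν w' × GoodPosition ν w' × ((+ 2) ∣ (w - w')) ×
    ∃[ m₀ ] StrongInterlace ρ (μ ᵛ) (ν +𝟏 m₀))
lemma7p6 d _ ρ ρ-involutive n _ μ w dominant pure goodPosition realOrCM =
  ν , - w , ν-dominant , ν-pure , ν-goodPosition , Signed.∣⇒∣ᵤ (Signed.divides w (double w)) ,
  + 0 , strongInterlace-+𝟏0 {λ′ = μ ᵛ} ν-interlaces
  where
  double : ∀ w → w - - w ≡ w * + 2
  double = solve-∀
  skew : ∃ (Skew ρ (- w))
  skew = realOrCM⇒skew ρ ρ-involutive w realOrCM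
  open Descent ρ ρ-involutive μ w dominant pure goodPosition (proj₁ skew) (proj₂ skew)
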